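{- Let $d$ be a positive integer, let $H=(V,E)$ be a hypergraph, let $S\subseteq V$, and let $H'=\textsc{Group}(H,S)$. If $H$ is $d$-flat, then $H'$ is $d$-flat.
   Context: A hypergraph is a pair $H=(V,E)$ with $V$ finite and $E\subseteq 2^V$. A $(d+1)$-semi-ladder in $H$ is a pair $(W,F)$ with $W=\{w_0,\ldots,w_{d+1}\}\subseteq V$, $F=\{f_0,\ldots,f_{d+1}\}\subseteq E$, $w_i\notin f_i$ for each $i$, and $w_i\in f_j$ whenever $i<j$; $H$ is $d$-flat if it has no $(d+1)$-semi-ladder. For $S\subseteq V$, $\textsc{Group}(H,S)=(V',E')$ where $V'=(V\setminus S)\cup\{v\}$ for a new vertex $v\notin V$, and $E'$ consists of $e\setminus S$ for each $e\in E$ with $S\not\subseteq e$, and $(e\setminus S)\cup\{v\}$ for each $e\in E$ with $S\subseteq e$. -}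

module Defs where

open import Data.Nat using (ℕ; suc)
open import Data.Fin using (Fin; _<_)
open import Data.Bool using (Bool; true; false)
open import Data.Product using (Σ; _×_; _,_)
open import Data.Sum using (_⊎_; inj₁; inj₂)
open import Data.Unit using (⊤; tt)
open import Function.Bundles using (_↔_)
open import Relation.Nullary using (¬_)
open import Relation.Binary.PropositionalEquality using (_≡_; _≗_)

Subset : Set → Set
Subset V = V → Bool

_∈_ : {V : Set} → V → Subset V → Set
x ∈ A = A x ≡ true

_∉_ : {V : Set} → V → Subset V → Set
x ∉ A = A x ≡ false

_⊆_ : {V : Set} → Subset V → Subset V → Set
A ⊆ B = ∀ x → x ∈ A → x ∈ B

record Hypergraph : Set₁ where
  field
    V : Set
    E : Subset V → Set
open Hypergraph public

Finite : Set → Set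
Finite A = Σ ℕ λ n → A ↔ Fin n

-- A k-semi-ladder: vertices w_0..w_k and edges f_0..f_k of H with
-- w_i ∉ f_i and w_i ∈ f_j whenever i < j.
-- (Distinctness of the w_i and of the f_i follows from these conditions.)
record SemiLadder (k : ℕ) (H : Hypergraph) : Set where
  field
    w     : Fin (suc k) → V H
    f     : Fin (suc k) → Subset (V H)
    f∈E   : ∀ i → E H (f i)
    w∉f   : ∀ i → w i ∉ f i
    w∈f   : ∀ i j → i < j → w i ∈ f j

Flat : ℕ → Hypergraph → Set
Flat d H = ¬ SemiLadder (suc d) H

-- Group(H, S): vertex set (V ∖ S) ∪ {v} with v a fresh vertex,
-- realised as (Σ x ∈ V, x ∉ S) ⊎ ⊤ (inj₂ tt is the new vertex v).
GroupV : (H : Hypergraph) → Subset (V H) → Set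
GroupV H S = (Σ (V H) λ x → x ∉ S) ⊎ ⊤

-- (e ∖ S) if b = false, (e ∖ S) ∪ {v} if b = true.
groupEdge : (H : Hypergraph) (S : Subset (V H)) → Subset (V H) → Bool →
            Subset (GroupV H S)
groupEdge H S e b (inj₁ (x , _)) = e x
groupEdge H S e b (inj₂ tt)      = b

Group : (H : Hypergraph) → Subset (V H) → Hypergraph
Group H S = record
  { V = GroupV H S
  ; E = λ f → Σ (Subset (V H)) λ e → E H e ×
          ( ((¬ (S ⊆ e)) × (f ≗ groupEdge H S e false))
          ⊎ ((S ⊆ e)     × (f ≗ groupEdge H S e true)) )
  }

-- A semi-ladder of Group(H, S) pulls back to a semi-ladder of H of the same length: keep the edges
-- e underlying the f_i, keep every old vertex w_i, and replace the new vertex v, if it is some w_i,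
-- by a vertex of S missing e_i.  Such a vertex exists because v ∉ f_i forces S ⊈ e_i, and it lies in
-- every later e_j because v ∈ f_j forces S ⊆ e_j.
module Submission where

open import Defs
open import Data.Nat using (ℕ; _≤_)
open import Data.Fin using (Fin; _<_)
open import Data.Fin.Properties using (¬∀⟶∃¬)
open import Data.Bool using (Bool; true; false)
open import Data.Bool.Properties using (_≟_)
open import Data.Product using (Σ; _×_; _,_; proj₁; proj₂)
open import Data.Sum using (inj₁; inj₂)
open import Data.Unit using (tt)
open import Function.Bundles using (Inverse)
open import Relation.Nullary using (¬_; contradiction)
open import Relation.Nullary.Decidable using (_→-dec_)
open import Relation.Binary.PropositionalEquality using (_≡_; refl; sym; trans; subst)

¬[a→b]⇒a×¬b : {a b : Bool} → ¬ (a ≡ true → b ≡ true) → a ≡ true × b ≡ false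
¬[a→b]⇒a×¬b {true}  {false} _   = refl , refl
¬[a→b]⇒a×¬b {true}  {true}  ¬ab = contradiction (λ _ → refl) ¬ab
¬[a→b]⇒a×¬b {false}         ¬ab = contradiction (λ ()) ¬ab

⊈⇒∃∈∉ : {A : Set} → Finite A → {S e : Subset A} → ¬ (S ⊆ e) → Σ A λ x → x ∈ S × x ∉ e
⊈⇒∃∈∉ (n , A↔Fin) {S} {e} S⊈e =
  let (i , ¬P) = ¬∀⟶∃¬ n P (λ i → (S (from i) ≟ true) →-dec (e (from i) ≟ true)) ¬∀P
  in from i , ¬[a→b]⇒a×¬b ¬P
  where
  open Inverse A↔Fin using (to; from; strictlyInverseʳ)
  P : Fin n → Set
  P i = from i ∈ S → from i ∈ e
  ¬∀P : ¬ (∀ i → P i)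
  ¬∀P ∀P = S⊈e λ x → subst (λ y → y ∈ S → y ∈ e) (strictlyInverseʳ x) (∀P (to x))

module _ {H : Hypergraph} {S : Subset (V H)} {f : Subset (GroupV H S)} (f∈E : E (Group H S) f) where

  underlying : Subset (V H)
  underlying = proj₁ f∈E

  underlying∈E : E H underlying
  underlying∈E = proj₁ (proj₂ f∈E)

  group-old : ∀ x (x∉S : x ∉ S) → f (inj₁ (x , x∉S)) ≡ underlying x
  group-old x x∉S with proj₂ (proj₂ f∈E)
  ... | inj₁ (_ , f≗) = f≗ (inj₁ (x , x∉S))
  ... | inj₂ (_ , f≗) = f≗ (inj₁ (x , x∉S))

  group-new∈⇒⊆ : inj₂ tt ∈ f → S ⊆ underlying
  group-new∈⇒⊆ v∈f with proj₂ (proj₂ f∈E)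
  ... | inj₂ (S⊆e , _) = S⊆e
  ... | inj₁ (_ , f≗) with trans (sym v∈f) (f≗ (inj₂ tt))
  ... | ()

  group-new∉⇒⊈ : inj₂ tt ∉ f → ¬ (S ⊆ underlying)
  group-new∉⇒⊈ v∉f with proj₂ (proj₂ f∈E)
  ... | inj₁ (S⊈e , _) = S⊈e
  ... | inj₂ (_ , f≗) with trans (sym v∉f) (f≗ (inj₂ tt))
  ... | ()

module _ {H : Hypergraph} (fin : Finite (V H)) {S : Subset (V H)} where

  module _ {f : Subset (GroupV H S)} (f∈E : E (Group H S) f) where

    ungroup : (y : GroupV H S) → y ∉ f → V H
    ungroup (inj₁ (x , _)) _   = x
    ungroup (inj₂ tt)      v∉f = proj₁ (⊈⇒∃∈∉ fin (group-new∉⇒⊈ f∈E v∉f))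

    ungroup∉ : ∀ y (y∉f : y ∉ f) → ungroup y y∉f ∉ underlying f∈E
    ungroup∉ (inj₁ (x , x∉S)) x∉f = trans (sym (group-old f∈E x x∉S)) x∉f
    ungroup∉ (inj₂ tt)        v∉f = proj₂ (proj₂ (⊈⇒∃∈∉ fin (group-new∉⇒⊈ f∈E v∉f)))

    ungroup∈ : ∀ {g} (g∈E : E (Group H S) g) y (y∉f : y ∉ f) → y ∈ g →
               ungroup y y∉f ∈ underlying g∈E
    ungroup∈ g∈E (inj₁ (x , x∉S)) _   x∈g = trans (sym (group-old g∈E x x∉S)) x∈g
    ungroup∈ g∈E (inj₂ tt)        v∉f v∈g =
      group-new∈⇒⊆ g∈E v∈g _ (proj₁ (proj₂ (⊈⇒∃∈∉ fin (group-new∉⇒⊈ f∈E v∉f))))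

  ungroup-SemiLadder : ∀ {k} → SemiLadder k (Group H S) → SemiLadder k H
  ungroup-SemiLadder L = record
    { w   = λ i → ungroup (f∈E i) (w i) (w∉f i)
    ; f   = λ i → underlying (f∈E i)
    ; f∈E = λ i → underlying∈E (f∈E i)
    ; w∉f = λ i → ungroup∉ (f∈E i) (w i) (w∉f i)
    ; w∈f = λ i j i<j → ungroup∈ (f∈E i) (f∈E j) (w i) (w∉f i) (w∈f i j i<j)
    }
    where open SemiLadder L

lemma5 : (d : ℕ) → 1 ≤ d → (H : Hypergraph) → Finite (V H) →
         (S : Subset (V H)) → Flat d H → Flat d (Group H S)
lemma5 d _ H fin S flat L = flat (ungroup-SemiLadder fin L)
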